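{- Let $n,t_1,t_2\in\mathbb{N}$ with $t_1\ge t_2$. Then $$R(C_{t_1},Q_n)=n+t_1-1\qquad \text{and}\qquad R(\mathcal{C}_{t_1,t_2},Q_n)=n+t_1+1.$$
   Context: The Boolean lattice $Q_N$ is the poset of all subsets of $\{1,\dots,N\}$ ordered by inclusion. A copy of a poset $P'$ in a poset $P$ is an induced subposet of $P$ isomorphic to $P'$. In a blue/red coloring each element of a poset gets color blue or red; a subposet is blue (red) if all its elements are blue (red). For posets $P_1,P_2$, $R(P_1,P_2)$ is the smallest $N$ such that every blue/red coloring of $Q_N$ contains a blue copy of $P_1$ or a red copy of $P_2$. $C_t$ denotes a chain (linear order) on $t$ elements. For posets $P_1,P_2$, the parallel composition $P_1+P_2$ is the poset consisting of disjoint copies of $P_1$ and $P_2$ with every element of one incomparable to every element of the other. The chain composition is $\mathcal{C}_{t_1,\dots,t_\ell}=C_{t_1}+\dots+C_{t_\ell}$. -}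

module Defs where

open import Data.Nat using (ℕ; _≤_; _+_; _∸_)
open import Data.Bool using (Bool; true; false)
open import Data.Fin using (Fin)
import Data.Fin as Fin
open import Data.Fin.Subset using (Subset; _⊆_)
open import Data.Sum using (_⊎_; inj₁; inj₂)
open import Data.Product using (Σ; _×_)
open import Relation.Binary.PropositionalEquality using (_≡_)
open import Function.Definitions using (Injective)

record Poset : Set₁ where
  field
    Carrier : Set
    _≼_     : Carrier → Carrier → Set
open Poset public

Q : ℕ → Poset
Q N = record { Carrier = Subset N ; _≼_ = _⊆_ }

C : ℕ → Poset
C t = record { Carrier = Fin t ; _≼_ = Fin._≤_ }

data ParLe (P₁ P₂ : Poset) : Carrier P₁ ⊎ Carrier P₂ → Carrier P₁ ⊎ Carrier P₂ → Set where
  left  : ∀ {a b} → _≼_ P₁ a b → ParLe P₁ P₂ (inj₁ a) (inj₁ b)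
  right : ∀ {a b} → _≼_ P₂ a b → ParLe P₁ P₂ (inj₂ a) (inj₂ b)

_⊕_ : Poset → Poset → Poset
P₁ ⊕ P₂ = record { Carrier = Carrier P₁ ⊎ Carrier P₂ ; _≼_ = ParLe P₁ P₂ }

C₂ : ℕ → ℕ → Poset
C₂ t₁ t₂ = C t₁ ⊕ C t₂

Copy : Poset → ℕ → Set
Copy P N = Σ (Carrier P → Subset N) λ f →
  Injective _≡_ _≡_ f ×
  (∀ x y → (_≼_ P x y → f x ⊆ f y) × (f x ⊆ f y → _≼_ P x y))

-- Colouring: true = blue, false = red.
Colouring : ℕ → Set
Colouring N = Subset N → Bool

MonoCopy : ∀ {N} → Colouring N → Bool → Poset → Set
MonoCopy {N} c col P = Σ (Copy P N) λ cp → ∀ x → c (Data.Product.proj₁ cp x) ≡ col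

Arrows : ℕ → Poset → Poset → Set
Arrows N P₁ P₂ = ∀ (c : Colouring N) → MonoCopy c true P₁ ⊎ MonoCopy c false P₂

IsRamsey : Poset → Poset → ℕ → Set
IsRamsey P₁ P₂ m = Arrows m P₁ P₂ × (∀ N → Arrows N P₁ P₂ → m ≤ N)

-- Q_{n+t} contains the grid Q_n × C_{t+1} via (S , k) ↦ S ++ {first k of the last t
-- coordinates}.  Call T₀ ⊆ ⋯ ⊆ Tⱼ₋₁ with Tᵢ blue on layer i a blue chain of length j.  Either one of
-- length t+1 exists, which is a blue C_{t+1}, or the length h(S) ≤ t of the longest blue chain below S
-- is monotone in S and (S , h(S)) is red by maximality, which gives a red Q_n.  For C_{t₁}+C_{t₂} apply
-- this in the two incomparable faces {1} × Q_N and {2} × Q_N of Q_{N+2}.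
-- Lower bounds colour by size, which grows strictly along chains: "blue iff |X| ≥ n" has neither a blue
-- C_{t₁} in Q_{n+t₁-2} nor a red Q_n; "blue iff |X| < t₁ or X = [N]" has no red Q_n in Q_{n+t₁}, and no
-- blue C_{t₁}+C_{t₂}, since its C_{t₁} would contain ∅ or [N], which are comparable to everything.

module Submission where

open import Defs
open import Data.Bool using (Bool; true; false; _≟_)
open import Data.Bool.Properties using (¬-not)
open import Data.Empty using (⊥-elim)
open import Data.Fin as F using (Fin; zero; suc; toℕ; fromℕ; inject≤)
open import Data.Fin.Properties using (toℕ-fromℕ; toℕ-inject≤; toℕ≤pred[n])
  renaming (≤-antisym to Fin-≤-antisym; suc-injective to Fin-suc-injective)
open import Data.Fin.Subset using (Subset; _⊆_; _⊈_; ⊥; ⊤; ⁅_⁆; ∣_∣; inside; outside)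
open import Data.Fin.Subset.Properties
  using (_⊆?_; anySubset?; drop-∷-⊆; out⊆; s⊆s; ⊆-refl; ⊆-trans; ⊆-antisym; ⊆-reflexive; ⊆⊤; ⊥⊆;
         p⊆q⇒∣p∣≤∣q∣; ∣p∣≤n; ∣p∣≡n⇒p≡⊤; x∈⁅x⁆; x∈⁅y⁆⇒x≡y)
open import Data.Nat using (ℕ; zero; suc; _+_; _∸_; _≤_; _<_; z≤n; s≤s; _≤?_; _<?_)
open import Data.Nat.Properties
  using (≤-refl; ≤-reflexive; ≤-trans; ≤-antisym; ≤-pred; <-irrefl; ≮⇒≥; ≰⇒>; n≤0⇒n≡0; 0≢1+n;
         m≤n⇒m≤1+n; m≤n⇒m<n∨m≡n; m+n≤o⇒n≤o; +-identityʳ; +-suc; +-comm; +-monoˡ-≤; +-cancelʳ-≤;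
         +-∸-assoc; module ≤-Reasoning)
open import Data.Product using (Σ; _×_; _,_; proj₁; proj₂)
open import Data.Sum using (_⊎_; inj₁; inj₂; [_,_]; [_,_]′)
open import Data.Sum.Properties using (inj₁-injective)
open import Data.Vec using ([]; _∷_; _++_; here)
open import Function using (_∘_)
open import Function.Definitions using (Injective)
open import Relation.Binary.PropositionalEquality using (_≡_; _≢_; refl; sym; trans; cong; subst; subst₂)
open import Relation.Nullary using (¬_; Dec; yes; no; does; contradiction)
open import Relation.Nullary.Decidable using (map′; _×-dec_; _⊎-dec_)

private variable
  m n N t : ℕ

does-true : ∀ {P : Set} (P? : Dec P) → does P? ≡ true → P
does-true (yes p) _ = p

does-false : ∀ {P : Set} (P? : Dec P) → does P? ≡ false → ¬ P
does-false (no ¬p) _ = ¬p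

∣p∣≡0⇒p≡⊥ : {p : Subset n} → ∣ p ∣ ≡ 0 → p ≡ ⊥
∣p∣≡0⇒p≡⊥ {p = []} _ = refl
∣p∣≡0⇒p≡⊥ {p = outside ∷ p} eq = cong (outside ∷_) (∣p∣≡0⇒p≡⊥ eq)

p⊆q∧p≢q⇒∣p∣<∣q∣ : {p q : Subset n} → p ⊆ q → p ≢ q → ∣ p ∣ < ∣ q ∣
p⊆q∧p≢q⇒∣p∣<∣q∣ {p = []} {[]} _ p≢q = contradiction refl p≢q
p⊆q∧p≢q⇒∣p∣<∣q∣ {p = outside ∷ p} {outside ∷ q} p⊆q p≢q =
  p⊆q∧p≢q⇒∣p∣<∣q∣ (drop-∷-⊆ p⊆q) (p≢q ∘ cong (outside ∷_))
p⊆q∧p≢q⇒∣p∣<∣q∣ {p = outside ∷ p} {inside ∷ q} p⊆q _ = s≤s (p⊆q⇒∣p∣≤∣q∣ (drop-∷-⊆ p⊆q))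
p⊆q∧p≢q⇒∣p∣<∣q∣ {p = inside ∷ p} {outside ∷ q} p⊆q _ = contradiction (p⊆q here) λ ()
p⊆q∧p≢q⇒∣p∣<∣q∣ {p = inside ∷ p} {inside ∷ q} p⊆q p≢q =
  s≤s (p⊆q∧p≢q⇒∣p∣<∣q∣ (drop-∷-⊆ p⊆q) (p≢q ∘ cong (inside ∷_)))

++⁺ : {p p′ : Subset m} {q q′ : Subset n} → p ⊆ p′ → q ⊆ q′ → p ++ q ⊆ p′ ++ q′
++⁺ {p = []} {[]} _ q⊆q′ = q⊆q′
++⁺ {p = outside ∷ p} {_ ∷ p′} p⊆p′ q⊆q′ = out⊆ (++⁺ (drop-∷-⊆ p⊆p′) q⊆q′)
++⁺ {p = inside ∷ p} {inside ∷ p′} p⊆p′ q⊆q′ = s⊆s (++⁺ (drop-∷-⊆ p⊆p′) q⊆q′)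
++⁺ {p = inside ∷ p} {outside ∷ p′} p⊆p′ _ = contradiction (p⊆p′ here) λ ()

++⁻ˡ : {p p′ : Subset m} {q q′ : Subset n} → p ++ q ⊆ p′ ++ q′ → p ⊆ p′
++⁻ˡ {p = []} {[]} _ ()
++⁻ˡ {p = outside ∷ p} {_ ∷ p′} {q} {q′} h = out⊆ (++⁻ˡ {q = q} {q′} (drop-∷-⊆ h))
++⁻ˡ {p = inside ∷ p} {inside ∷ p′} {q} {q′} h = s⊆s (++⁻ˡ {q = q} {q′} (drop-∷-⊆ h))
++⁻ˡ {p = inside ∷ p} {outside ∷ p′} h = contradiction (h here) λ ()

++⁻ʳ : {p p′ : Subset m} {q q′ : Subset n} → p ++ q ⊆ p′ ++ q′ → q ⊆ q′
++⁻ʳ {p = []} {[]} h = h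
++⁻ʳ {p = _ ∷ p} {_ ∷ p′} h = ++⁻ʳ {p = p} {p′} (drop-∷-⊆ h)

initial : (n k : ℕ) → Subset n
initial zero _ = []
initial (suc n) zero = outside ∷ initial n zero
initial (suc n) (suc k) = inside ∷ initial n k

initial-mono : ∀ n {k l} → k ≤ l → initial n k ⊆ initial n l
initial-mono zero _ = ⊆-refl
initial-mono (suc n) {zero} {zero} _ = ⊆-refl
initial-mono (suc n) {zero} {suc l} _ = out⊆ (initial-mono n z≤n)
initial-mono (suc n) {suc k} {suc l} (s≤s k≤l) = s⊆s (initial-mono n k≤l)

initial-⊆⇒≤ : ∀ n {k l} → k ≤ n → initial n k ⊆ initial n l → k ≤ l
initial-⊆⇒≤ _ {zero} _ _ = z≤n
initial-⊆⇒≤ (suc n) {suc k} {zero} _ h = contradiction (h here) λ ()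
initial-⊆⇒≤ (suc n) {suc k} {suc l} (s≤s k≤n) h = s≤s (initial-⊆⇒≤ n k≤n (drop-∷-⊆ h))

OrderEmbedding : (P : Poset) → (Carrier P → Subset N) → Set
OrderEmbedding P f = ∀ x y → (_≼_ P x y → f x ⊆ f y) × (f x ⊆ f y → _≼_ P x y)

embedding⇒copy : {P : Poset} → (∀ {x y} → _≼_ P x y → _≼_ P y x → x ≡ y) →
                 (f : Carrier P → Subset N) → OrderEmbedding P f → Copy P N
embedding⇒copy antisym f emb = f , injective , emb
  where
  injective : Injective _≡_ _≡_ f
  injective {x} {y} fx≡fy =
    antisym (proj₂ (emb x y) (⊆-reflexive fx≡fy)) (proj₂ (emb y x) (⊆-reflexive (sym fx≡fy)))

copy-∘ : {P : Poset} → Copy (Q m) N → Copy P m → Copy P N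
copy-∘ (e , e-inj , e-emb) (g , g-inj , g-emb) =
  e ∘ g , g-inj ∘ e-inj ,
  λ x y → proj₁ (e-emb _ _) ∘ proj₁ (g-emb x y) , proj₂ (g-emb x y) ∘ proj₂ (e-emb _ _)

monoCopy-∘ : {P : Poset} {col : Bool} (c : Colouring N) (e : Copy (Q m) N) →
             MonoCopy (c ∘ proj₁ e) col P → MonoCopy c col P
monoCopy-∘ _ e (g , mono) = copy-∘ e g , mono

prefix : (p : Subset m) → Copy (Q n) (m + n)
prefix p = embedding⇒copy ⊆-antisym (p ++_) λ _ _ → ++⁺ ⊆-refl , ++⁻ʳ {p = p} {p}

initial-chain : Copy (C (suc n)) n
initial-chain {n} = embedding⇒copy Fin-≤-antisym (initial n ∘ toℕ)
  λ x _ → initial-mono n , initial-⊆⇒≤ n (toℕ≤pred[n] x)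

monoCopy-inject≤ : {col : Bool} (c : Colouring N) → t ≤ m → MonoCopy c col (C m) → MonoCopy c col (C t)
monoCopy-inject≤ {t = t} _ t≤m ((f , _ , emb) , mono) =
  embedding⇒copy Fin-≤-antisym (f ∘ ι) emb′ , mono ∘ ι
  where
  ι : Fin t → Fin _
  ι x = inject≤ x t≤m
  emb′ : OrderEmbedding (C t) (f ∘ ι)
  emb′ x y = proj₁ (emb (ι x) (ι y)) ∘ subst₂ _≤_ (sym (toℕ-inject≤ x t≤m)) (sym (toℕ-inject≤ y t≤m)) ,
             subst₂ _≤_ (toℕ-inject≤ x t≤m) (toℕ-inject≤ y t≤m) ∘ proj₂ (emb (ι x) (ι y))

copy-⊕ : {P₁ P₂ : Poset} (g₁ : Copy P₁ N) (g₂ : Copy P₂ N) →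
         (∀ x y → proj₁ g₁ x ⊈ proj₁ g₂ y) → (∀ x y → proj₁ g₂ y ⊈ proj₁ g₁ x) → Copy (P₁ ⊕ P₂) N
copy-⊕ {P₁ = P₁} {P₂} (f₁ , f₁-inj , emb₁) (f₂ , f₂-inj , emb₂) f₁⊈f₂ f₂⊈f₁ = f , injective , emb
  where
  f : Carrier (P₁ ⊕ P₂) → Subset _
  f = [ f₁ , f₂ ]′
  injective : Injective _≡_ _≡_ f
  injective {inj₁ x} {inj₁ y} eq = cong inj₁ (f₁-inj eq)
  injective {inj₁ x} {inj₂ y} eq = ⊥-elim (f₁⊈f₂ x y (⊆-reflexive eq))
  injective {inj₂ x} {inj₁ y} eq = ⊥-elim (f₂⊈f₁ y x (⊆-reflexive eq))
  injective {inj₂ x} {inj₂ y} eq = cong inj₂ (f₂-inj eq)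
  emb : OrderEmbedding (P₁ ⊕ P₂) f
  emb (inj₁ x) (inj₁ y) = (λ { (left x≼y) → proj₁ (emb₁ x y) x≼y }) , left ∘ proj₂ (emb₁ x y)
  emb (inj₁ x) (inj₂ y) = (λ ()) , λ h → ⊥-elim (f₁⊈f₂ x y h)
  emb (inj₂ x) (inj₁ y) = (λ ()) , λ h → ⊥-elim (f₂⊈f₁ y x h)
  emb (inj₂ x) (inj₂ y) = (λ { (right x≼y) → proj₁ (emb₂ x y) x≼y }) , right ∘ proj₂ (emb₂ x y)

chain-size-gap : ∀ t (f : Fin (suc t) → Subset N) → Injective _≡_ _≡_ f →
                 (∀ {x y} → x F.≤ y → f x ⊆ f y) → ∣ f zero ∣ + t ≤ ∣ f (fromℕ t) ∣
chain-size-gap zero f _ _ = ≤-reflexive (+-identityʳ _)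
chain-size-gap (suc t) f inj mono = begin
  ∣ f zero ∣ + suc t      ≡⟨ +-suc ∣ f zero ∣ t ⟩
  suc ∣ f zero ∣ + t      ≤⟨ +-monoˡ-≤ t first-step ⟩
  ∣ f (suc zero) ∣ + t    ≤⟨ chain-size-gap t (f ∘ suc) (Fin-suc-injective ∘ inj) (mono ∘ s≤s) ⟩
  ∣ f (fromℕ (suc t)) ∣   ∎
  where
  open ≤-Reasoning
  first-step : ∣ f zero ∣ < ∣ f (suc zero) ∣
  first-step = p⊆q∧p≢q⇒∣p∣<∣q∣ (mono z≤n) (0≢1+n ∘ cong toℕ ∘ inj)

copy-size-gap : (g : Copy (C (suc t)) N) → ∣ proj₁ g zero ∣ + t ≤ ∣ proj₁ g (fromℕ t) ∣
copy-size-gap {t} (f , inj , emb) = chain-size-gap t f inj (proj₁ (emb _ _))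

cube-size-gap : (g : Copy (Q n) N) → ∣ proj₁ g (initial n 0) ∣ + n ≤ ∣ proj₁ g (initial n n) ∣
cube-size-gap {n} g = subst (λ k → ∣ proj₁ g (initial n 0) ∣ + n ≤ ∣ proj₁ g (initial n k) ∣)
                            (toℕ-fromℕ n) (copy-size-gap (copy-∘ g initial-chain))

LayerColouring : ℕ → Set
LayerColouring n = Subset n → ℕ → Bool

module _ {n : ℕ} where

  private variable
    χ : LayerColouring n
    j : ℕ
    A S S′ : Subset n

  shift : LayerColouring n → LayerColouring n
  shift χ T k = χ T (suc k)

  -- BlueChain χ j A S : sets A ⊆ T₀ ⊆ ⋯ ⊆ Tⱼ₋₁ ⊆ S with χ Tᵢ i ≡ true.  Chains are built from the
  -- bottom, the tail being a chain for shift χ, so that element x lies on layer toℕ x.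
  data BlueChain (χ : LayerColouring n) : ℕ → Subset n → Subset n → Set where
    stop : A ⊆ S → BlueChain χ zero A S
    cons : ∀ {T} → A ⊆ T → χ T 0 ≡ true → BlueChain (shift χ) j T S → BlueChain χ (suc j) A S

  blueChain? : (χ : LayerColouring n) (j : ℕ) (A S : Subset n) → Dec (BlueChain χ j A S)
  blueChain? χ zero A S = map′ stop (λ { (stop A⊆S) → A⊆S }) (A ⊆? S)
  blueChain? χ (suc j) A S =
    map′ uncurried-cons uncons
         (anySubset? λ T → A ⊆? T ×-dec χ T 0 ≟ true ×-dec blueChain? (shift χ) j T S)
    where
    Step : Set
    Step = Σ (Subset n) λ T → A ⊆ T × χ T 0 ≡ true × BlueChain (shift χ) j T S
    uncurried-cons : Step → BlueChain χ (suc j) A S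
    uncurried-cons (_ , A⊆T , blue , rest) = cons A⊆T blue rest
    uncons : BlueChain χ (suc j) A S → Step
    uncons (cons A⊆T blue rest) = _ , A⊆T , blue , rest

  blueChain-mono : S ⊆ S′ → BlueChain χ j A S → BlueChain χ j A S′
  blueChain-mono S⊆S′ (stop A⊆S) = stop (⊆-trans A⊆S S⊆S′)
  blueChain-mono S⊆S′ (cons A⊆T blue rest) = cons A⊆T blue (blueChain-mono S⊆S′ rest)

  blueChain-snoc : BlueChain χ j A S → χ S j ≡ true → BlueChain χ (suc j) A S
  blueChain-snoc (stop A⊆S) blueS = cons A⊆S blueS (stop ⊆-refl)
  blueChain-snoc (cons A⊆T blue rest) blueS = cons A⊆T blue (blueChain-snoc rest blueS)

  element : BlueChain χ j A S → Fin j → Subset n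
  element (cons {T = T} _ _ _) zero = T
  element (cons _ _ rest) (suc x) = element rest x

  element-blue : (c : BlueChain χ j A S) (x : Fin j) → χ (element c x) (toℕ x) ≡ true
  element-blue (cons _ blue _) zero = blue
  element-blue (cons _ _ rest) (suc x) = element-blue rest x

  element-lower : (c : BlueChain χ j A S) (x : Fin j) → A ⊆ element c x
  element-lower (cons A⊆T _ _) zero = A⊆T
  element-lower (cons A⊆T _ rest) (suc x) = ⊆-trans A⊆T (element-lower rest x)

  element-mono : (c : BlueChain χ j A S) {x y : Fin j} → x F.≤ y → element c x ⊆ element c y
  element-mono (cons _ _ _) {zero} {zero} _ = ⊆-refl
  element-mono (cons _ _ rest) {zero} {suc y} _ = element-lower rest y
  element-mono (cons _ _ rest) {suc x} {suc y} (s≤s x≤y) = element-mono rest x≤y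

record RedSection (χ : LayerColouring n) : Set where
  field
    level      : Subset n → ℕ
    level-mono : ∀ {S T} → S ⊆ T → level S ≤ level T
    level-red  : ∀ S → χ S (level S) ≡ false

module _ (χ : LayerColouring n) where

  height : ℕ → Subset n → ℕ
  height zero _ = 0
  height (suc j) S with blueChain? χ (suc j) ⊥ S
  ... | yes _ = suc j
  ... | no _ = height j S

  height-blueChain : ∀ j S → BlueChain χ (height j S) ⊥ S
  height-blueChain zero S = stop ⊥⊆
  height-blueChain (suc j) S with blueChain? χ (suc j) ⊥ S
  ... | yes chain = chain
  ... | no _ = height-blueChain j S

  height-≤ : ∀ j S → height j S ≤ j
  height-≤ zero S = z≤n
  height-≤ (suc j) S with blueChain? χ (suc j) ⊥ S
  ... | yes _ = ≤-refl
  ... | no _ = m≤n⇒m≤1+n (height-≤ j S)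

  height-maximal : ∀ j S {l} → l ≤ j → BlueChain χ l ⊥ S → l ≤ height j S
  height-maximal zero S l≤0 _ = l≤0
  height-maximal (suc j) S l≤1+j chain with blueChain? χ (suc j) ⊥ S
  ... | yes _ = l≤1+j
  ... | no ¬chain with m≤n⇒m<n∨m≡n l≤1+j
  ...   | inj₁ l<1+j = height-maximal j S (≤-pred l<1+j) chain
  ...   | inj₂ refl = contradiction chain ¬chain

  blueChain⊎redSection : ∀ m → BlueChain χ (suc m) ⊥ ⊤ ⊎ RedSection χ
  blueChain⊎redSection m with blueChain? χ (suc m) ⊥ ⊤
  ... | yes chain = inj₁ chain
  ... | no ¬chain = inj₂ record
    { level      = height m
    ; level-mono = λ {S} S⊆T →
        height-maximal m _ (height-≤ m S) (blueChain-mono S⊆T (height-blueChain m S))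
    ; level-red  = λ S → ¬-not (tooLong S ∘ blueChain-snoc (height-blueChain m S))
    }
    where
    tooLong : ∀ S → ¬ BlueChain χ (suc (height m S)) ⊥ S
    tooLong S chain with m≤n⇒m<n∨m≡n (height-≤ m S)
    ... | inj₁ h<m = <-irrefl refl (height-maximal m S h<m chain)
    ... | inj₂ h≡m = ¬chain (blueChain-mono ⊆⊤ (subst (λ h → BlueChain χ (suc h) ⊥ S) h≡m chain))

arrows-C-Q : ∀ n t → Arrows (n + t) (C (suc t)) (Q n)
arrows-C-Q n t c = [ inj₁ ∘ blueCopy , inj₂ ∘ redCopy ]′ (blueChain⊎redSection χ t)
  where
  χ : LayerColouring n
  χ S k = c (S ++ initial t k)

  blueCopy : BlueChain χ (suc t) ⊥ ⊤ → MonoCopy c true (C (suc t))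
  blueCopy chain = embedding⇒copy Fin-≤-antisym f emb , element-blue chain
    where
    f : Fin (suc t) → Subset (n + t)
    f x = element chain x ++ initial t (toℕ x)
    emb : OrderEmbedding (C (suc t)) f
    emb x y = (λ x≤y → ++⁺ (element-mono chain x≤y) (initial-mono t x≤y)) ,
              initial-⊆⇒≤ t (toℕ≤pred[n] x) ∘ ++⁻ʳ {p = element chain x} {element chain y}

  redCopy : RedSection χ → MonoCopy c false (Q n)
  redCopy section = embedding⇒copy ⊆-antisym f emb , level-red
    where
    open RedSection section
    f : Subset n → Subset (n + t)
    f S = S ++ initial t (level S)
    emb : OrderEmbedding (Q n) f
    emb S T = (λ S⊆T → ++⁺ S⊆T (initial-mono t (level-mono S⊆T))) , ++⁻ˡ {p = S} {T}

arrows-C-Q⇒n+t≤N : ∀ n t → Arrows N (C (suc t)) (Q n) → n + t ≤ N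
arrows-C-Q⇒n+t≤N {N} n t arrows with arrows (λ X → does (n ≤? ∣ X ∣))
... | inj₁ (g@(f , _) , blue) = begin
  n + t               ≤⟨ +-monoˡ-≤ t (does-true (n ≤? _) (blue zero)) ⟩
  ∣ f zero ∣ + t      ≤⟨ copy-size-gap g ⟩
  ∣ f (fromℕ t) ∣     ≤⟨ ∣p∣≤n (f (fromℕ t)) ⟩
  N                   ∎
  where open ≤-Reasoning
... | inj₂ (g , red) =
  contradiction (m+n≤o⇒n≤o _ (cube-size-gap g)) (does-false (n ≤? _) (red (initial n n)))

arrows-C₂-Q⇒2+n+t≤N : ∀ n t t₂ → Arrows N (C₂ (suc t) (suc t₂)) (Q n) → 2 + (n + t) ≤ N
arrows-C₂-Q⇒2+n+t≤N {N} n t t₂ arrows = [ ⊥-elim ∘ noBlueCopy , redBound ]′ (arrows c)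
  where
  smallOrFull? : (X : Subset N) → Dec (∣ X ∣ < suc t ⊎ N ≤ ∣ X ∣)
  smallOrFull? X = ∣ X ∣ <? suc t ⊎-dec N ≤? ∣ X ∣

  c : Colouring N
  c = does ∘ smallOrFull?

  noBlueCopy : ¬ MonoCopy c true (C₂ (suc t) (suc t₂))
  noBlueCopy ((f , inj , emb) , blue) =
    [ top-small , top-full ]′ (does-true (smallOrFull? top) (blue (inj₁ (fromℕ t))))
    where
    bottom top : Subset N
    bottom = f (inj₁ zero)
    top = f (inj₁ (fromℕ t))
    gap : ∣ bottom ∣ + t ≤ ∣ top ∣
    gap = chain-size-gap t (f ∘ inj₁) (inj₁-injective ∘ inj) (proj₁ (emb _ _) ∘ left)
    top-small : ¬ ∣ top ∣ < suc t
    top-small top<1+t = contradiction (proj₂ (emb (inj₁ zero) (inj₂ zero)) bottom⊆other) λ ()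
      where
      bottom≡⊥ : bottom ≡ ⊥
      bottom≡⊥ = ∣p∣≡0⇒p≡⊥ (n≤0⇒n≡0 (+-cancelʳ-≤ t _ 0 (≤-trans gap (≤-pred top<1+t))))
      bottom⊆other : bottom ⊆ f (inj₂ zero)
      bottom⊆other = subst (_⊆ f (inj₂ zero)) (sym bottom≡⊥) ⊥⊆
    top-full : ¬ N ≤ ∣ top ∣
    top-full N≤top = contradiction (proj₂ (emb (inj₂ zero) (inj₁ (fromℕ t))) other⊆top) λ ()
      where
      top≡⊤ : top ≡ ⊤
      top≡⊤ = ∣p∣≡n⇒p≡⊤ (≤-antisym (∣p∣≤n top) N≤top)
      other⊆top : f (inj₂ zero) ⊆ top
      other⊆top = subst (f (inj₂ zero) ⊆_) (sym top≡⊤) ⊆⊤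

  redBound : MonoCopy c false (Q n) → 2 + (n + t) ≤ N
  redBound (g@(f , _) , red) = begin
    2 + (n + t)                   ≡⟨ cong (2 +_) (+-comm n t) ⟩
    suc (suc t + n)               ≤⟨ s≤s (+-monoˡ-≤ n (≮⇒≥ (not-red (initial n 0) ∘ inj₁))) ⟩
    suc (∣ f (initial n 0) ∣ + n) ≤⟨ s≤s (cube-size-gap g) ⟩
    suc ∣ f (initial n n) ∣       ≤⟨ ≰⇒> (not-red (initial n n) ∘ inj₂) ⟩
    N                             ∎
    where
    open ≤-Reasoning
    not-red : ∀ X → ¬ (∣ f X ∣ < suc t ⊎ N ≤ ∣ f X ∣)
    not-red X = does-false (smallOrFull? (f X)) (red X)

face : Fin 2 → Copy (Q N) (2 + N)
face i = prefix ⁅ i ⁆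

faces-incomparable : ∀ {i j : Fin 2} {X Y : Subset N} → i ≢ j → proj₁ (face i) X ⊈ proj₁ (face j) Y
faces-incomparable {i = i} {j} {X} {Y} i≢j h = i≢j (x∈⁅y⁆⇒x≡y j (++⁻ˡ {q = X} {Y} h (x∈⁅x⁆ i)))

arrows-C⇒arrows-C₂ : ∀ {t₁ t₂} {P : Poset} → t₂ ≤ t₁ → Arrows N (C t₁) P → Arrows (2 + N) (C₂ t₁ t₂) P
arrows-C⇒arrows-C₂ t₂≤t₁ arrows c
  with arrows (c ∘ proj₁ (face zero)) | arrows (c ∘ proj₁ (face (suc zero)))
... | inj₂ red | _ = inj₂ (monoCopy-∘ c (face zero) red)
... | inj₁ _ | inj₂ red = inj₂ (monoCopy-∘ c (face (suc zero)) red)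
... | inj₁ blue₁ | inj₁ blue₂ =
  inj₁ (copy-⊕ (proj₁ b₁) (proj₁ b₂) (λ _ _ → faces-incomparable {i = zero} {suc zero} λ ())
               (λ _ _ → faces-incomparable {i = suc zero} {zero} λ ()) ,
        [ proj₂ b₁ , proj₂ b₂ ])
  where
  b₁ : MonoCopy c true (C _)
  b₁ = monoCopy-∘ c (face zero) blue₁
  b₂ : MonoCopy c true (C _)
  b₂ = monoCopy-∘ c (face (suc zero)) (monoCopy-inject≤ (c ∘ proj₁ (face (suc zero))) t₂≤t₁ blue₂)

theorem4 : ∀ (n t₁ t₂ : ℕ) → 1 ≤ n → 1 ≤ t₂ → t₂ ≤ t₁ →
    IsRamsey (C t₁) (Q n) (n + t₁ ∸ 1) × IsRamsey (C₂ t₁ t₂) (Q n) (n + t₁ + 1)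
-- The argument also covers n = 0.
theorem4 n (suc t) (suc t₂) _ _ t₂≤t₁ =
  subst (IsRamsey (C (suc t)) (Q n)) (sym n+t₁∸1≡n+t)
        (arrows-C-Q n t , λ _ → arrows-C-Q⇒n+t≤N n t) ,
  subst (IsRamsey (C₂ (suc t) (suc t₂)) (Q n)) (sym n+t₁+1≡2+n+t)
        (arrows-C⇒arrows-C₂ t₂≤t₁ (arrows-C-Q n t) , λ _ → arrows-C₂-Q⇒2+n+t≤N n t t₂)
  where
  n+t₁∸1≡n+t : n + suc t ∸ 1 ≡ n + t
  n+t₁∸1≡n+t = +-∸-assoc n (s≤s z≤n)
  n+t₁+1≡2+n+t : n + suc t + 1 ≡ 2 + (n + t)
  n+t₁+1≡2+n+t = trans (+-comm (n + suc t) 1) (cong suc (+-suc n t))
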